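{- Let $S\subseteq\mathbb{Z}^2$ be a finite nonempty set that is orthogonally convex, $N_4$-connected, and bounded by two monotone increasing $N_4$-paths between $(0,0)$ and $(x_{\max},y_{\max})$, i.e. $(0,0)\in S$ and each of $\mathcal{B}_{lower}$ and $\mathcal{B}_{upper}$, with its points listed in lexicographic order, is a monotone increasing $N_4$-path starting at $(0,0)$ and ending at $(x_{\max},y_{\max})$, where $x_{\max},y_{\max}$ are the maximum $x$- and $y$-coordinates of points of $S$. Then $S$ is an antimatroidal point set.
   Context: A point $A=(x_A,y_A)\in\mathbb{Z}^2$ is regarded as a multiset over $\{x,y\}$. Write $A\subseteq B$ if $x_A\le x_B$ and $y_A\le y_B$; $A\subset B$ if $A\subseteq B$ and $A\neq B$. A finite nonempty set $S\subseteq\mathbb{Z}^2$ is an antimatroidal point set if (A1) for every $(x_A,y_A)\in S$ with $(x_A,y_A)\neq(0,0)$, either $(x_A-1,y_A)\in S$ or $(x_A,y_A-1)\in S$; (A2) for all $A,B\in S$ with $A\not\subseteq B$: if $x_A\ge x_B$ and $y_A\ge y_B$ then $(x_B+1,y_B)\in S$ or $(x_B,y_B+1)\in S$; if $x_A\le x_B$ and $y_A\ge y_B$ then $(x_B,y_B+1)\in S$; if $x_A\ge x_B$ and $y_A\le y_B$ then $(x_B+1,y_B)\in S$. $N_4(x,y)=\{(x\pm1,y),(x,y\pm1)\}$. An $N_4$-path is a sequence $A_0,\dots,A_n$ with $A_i\in N_4(A_{i-1})$; it is monotone increasing if $A_i\subset A_{i+1}$ for all $i$. $S$ is $N_4$-connected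 if any two points of $S$ are joined by an $N_4$-path all of whose points lie in $S$. $S$ is orthogonally convex if for every horizontal or vertical line $L$, $S\cap L$ is empty, a point, or a set of consecutive lattice points on $L$. $\mathcal{B}_{lower}=\{(x,y)\in S:(x+1,y)\notin S\ \vee\ (x,y-1)\notin S\ \vee\ (x+1,y-1)\notin S\}$, $\mathcal{B}_{upper}=\{(x,y)\in S:(x-1,y)\notin S\ \vee\ (x,y+1)\notin S\ \vee\ (x-1,y+1)\notin S\}$. -}

module Defs where

open import Data.Integer using (ℤ; _+_; _-_; _≤_; _<_; 0ℤ; 1ℤ)
open import Data.Product using (Σ; _×_; _,_; proj₁; proj₂)
open import Data.Sum using (_⊎_)
open import Data.List using (List; []; _∷_; head; last)
open import Data.List.Membership.Propositional using (_∈_)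
open import Data.List.Relation.Unary.Linked using (Linked)
open import Data.Maybe using (Maybe; just)
open import Relation.Binary.PropositionalEquality using (_≡_; _≢_)
open import Relation.Nullary using (¬_)

Point : Set
Point = ℤ × ℤ

-- A finite point set is represented by a list of points (set = membership).
PointSet : Set
PointSet = List Point

origin : Point
origin = (0ℤ , 0ℤ)

-- A ⊆ B  (multiset inclusion)
_⊆ₚ_ : Point → Point → Set
(xa , ya) ⊆ₚ (xb , yb) = (xa ≤ xb) × (ya ≤ yb)

_⊂ₚ_ : Point → Point → Set
A ⊂ₚ B = (A ⊆ₚ B) × (A ≢ B)

N4 : Point → Point → Set
N4 (x , y) B = (B ≡ (x + 1ℤ , y)) ⊎ (B ≡ (x - 1ℤ , y))
             ⊎ (B ≡ (x , y + 1ℤ)) ⊎ (B ≡ (x , y - 1ℤ))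

_<lex_ : Point → Point → Set
(xa , ya) <lex (xb , yb) = (xa < xb) ⊎ ((xa ≡ xb) × (ya < yb))

N4PathIn : PointSet → Point → Point → List Point → Set
N4PathIn S A B L =
  Linked (λ P Q → N4 P Q) L × (head L ≡ just A) × (last L ≡ just B)
  × (∀ {P} → P ∈ L → P ∈ S)

N4Connected : PointSet → Set
N4Connected S = ∀ {A B} → A ∈ S → B ∈ S → Σ (List Point) (N4PathIn S A B)

OrthConvex : PointSet → Set
OrthConvex S =
  (∀ {x₁ x₂ x y} → (x₁ , y) ∈ S → (x₂ , y) ∈ S → x₁ ≤ x → x ≤ x₂ → (x , y) ∈ S)
  × (∀ {x y₁ y₂ y} → (x , y₁) ∈ S → (x , y₂) ∈ S → y₁ ≤ y → y ≤ y₂ → (x , y) ∈ S)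

IsMaxX : PointSet → ℤ → Set
IsMaxX S m = (Σ ℤ λ y → (m , y) ∈ S) × (∀ {x y} → (x , y) ∈ S → x ≤ m)

IsMaxY : PointSet → ℤ → Set
IsMaxY S m = (Σ ℤ λ x → (x , m) ∈ S) × (∀ {x y} → (x , y) ∈ S → y ≤ m)

InLower : PointSet → Point → Set
InLower S (x , y) = ((x , y) ∈ S) ×
  ((¬ (x + 1ℤ , y) ∈ S) ⊎ (¬ (x , y - 1ℤ) ∈ S) ⊎ (¬ (x + 1ℤ , y - 1ℤ) ∈ S))

InUpper : PointSet → Point → Set
InUpper S (x , y) = ((x , y) ∈ S) ×
  ((¬ (x - 1ℤ , y) ∈ S) ⊎ (¬ (x , y + 1ℤ) ∈ S) ⊎ (¬ (x - 1ℤ , y + 1ℤ) ∈ S))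

MonotoneN4Path : List Point → Set
MonotoneN4Path L = Linked (λ P Q → N4 P Q × (P ⊂ₚ Q)) L

IsBoundaryPath : (Point → Set) → ℤ → ℤ → Set
IsBoundaryPath B xmax ymax = Σ (List Point) λ L →
  (∀ P → (P ∈ L → B P) × (B P → P ∈ L))
  × Linked _<lex_ L
  × MonotoneN4Path L
  × (head L ≡ just origin)
  × (last L ≡ just (xmax , ymax))

A1 : PointSet → Set
A1 S = ∀ {x y} → (x , y) ∈ S → (x , y) ≢ origin →
  ((x - 1ℤ , y) ∈ S) ⊎ ((x , y - 1ℤ) ∈ S)

A2 : PointSet → Set
A2 S = ∀ {xa ya xb yb} → (xa , ya) ∈ S → (xb , yb) ∈ S → ¬ ((xa , ya) ⊆ₚ (xb , yb)) →
  ((xb ≤ xa) × (yb ≤ ya) → ((xb + 1ℤ , yb) ∈ S) ⊎ ((xb , yb + 1ℤ) ∈ S))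
  × ((xa ≤ xb) × (yb ≤ ya) → (xb , yb + 1ℤ) ∈ S)
  × ((xb ≤ xa) × (ya ≤ yb) → (xb + 1ℤ , yb) ∈ S)

Antimatroidal : PointSet → Set
Antimatroidal S = (S ≢ []) × A1 S × A2 S

-- Both axioms are read off the boundary paths.  (A1): a point of S without
-- left neighbour lies on the upper path, and its predecessor there is its left
-- or lower neighbour.  (A2), B ⊆ A: B ≠ (xmax, ymax), so if its upper neighbour
-- is missing, B lies on the upper path and its successor there is its right or
-- upper neighbour.  (A2), xa ≤ xb and yb < ya: if the upper neighbour of B is
-- missing, B and the leftmost point C of S in row ya at or left of A both lie
-- on the upper path.  Points of a monotone path are comparable and C ⊄ B, so
-- B ⊆ C, which puts C in the column of B; a monotone path through two points
-- of a column runs through the segment between them, so the upper neighbour of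
-- B is in S after all.  The last case mirrors this with the lower path.
module Submission where

open import Defs
open import Data.Integer using (ℤ; _+_; _-_; _≤_; _<_; 0ℤ; 1ℤ; +_; -[1+_]; _⊓_)
import Data.Integer.Properties as ℤP
open import Data.Integer.Tactic.RingSolver using (solve-∀)
open import Data.Nat using (zero; suc)
open import Data.Product using (∃-syntax; _×_; _,_; proj₁; proj₂)
open import Data.Product.Properties using (≡-dec)
open import Data.Sum using (_⊎_; inj₁; inj₂)
import Data.Sum as Sum
open import Data.Empty using (⊥-elim)
open import Data.List using (List; []; _∷_; head; last)
open import Data.List.Membership.Propositional using (_∈_)
open import Data.List.Membership.DecPropositional (≡-dec ℤP._≟_ ℤP._≟_) using (_∈?_)
open import Data.List.Relation.Unary.Any using (here; there)
open import Data.List.Relation.Unary.Linked using (Linked; [-]; _∷_)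
open import Data.Maybe using (just)
open import Data.Maybe.Properties using (just-injective)
open import Relation.Binary.PropositionalEquality
open import Relation.Nullary using (¬_; yes; no)
open import Relation.Unary using (Decidable)

i-1+1≡i : ∀ i → i - 1ℤ + 1ℤ ≡ i
i-1+1≡i = solve-∀

i+1-1≡i : ∀ i → i + 1ℤ - 1ℤ ≡ i
i+1-1≡i = solve-∀

i-1-j≡i-j-1 : ∀ i j → i - 1ℤ - j ≡ i - j - 1ℤ
i-1-j≡i-j-1 = solve-∀

i<i+1 : ∀ i → i < i + 1ℤ
i<i+1 i = ℤP.suc[i]≤j⇒i<j (ℤP.≤-reflexive (ℤP.+-comm 1ℤ i))

i-1<i : ∀ i → i - 1ℤ < i
i-1<i i = subst (i - 1ℤ <_) (i-1+1≡i i) (i<i+1 (i - 1ℤ))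

lowerBound : ∀ {A : Set} (f : A → ℤ) (xs : List A) → ∃[ b ] (∀ {a} → a ∈ xs → b ≤ f a)
lowerBound f [] = 0ℤ , λ ()
lowerBound f (a ∷ as) =
  let b , b≤ = lowerBound f as
  in f a ⊓ b , λ { (here refl) → ℤP.i⊓j≤i (f a) b
                 ; (there p)   → ℤP.≤-trans (ℤP.i⊓j≤j (f a) b) (b≤ p) }

leftmost : ∀ {P : ℤ → Set} → Decidable P → (b : ℤ) → (∀ {i} → P i → b ≤ i) →
           ∀ {x} → P x → ∃[ c ] c ≤ x × P c × ¬ P (c - 1ℤ)
leftmost {P} P? b P≥b {x} Px with x - b in x-b≡n | ℤP.i≤j⇒0≤j-i (P≥b Px)
... | + n      | _  = descend n x x-b≡n Px
  where
  descend : ∀ n i → i - b ≡ + n → P i → ∃[ c ] c ≤ i × P c × ¬ P (c - 1ℤ)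
  descend n i _ Pi with P? (i - 1ℤ)
  ... | no ¬Pi-1 = i , ℤP.≤-refl , Pi , ¬Pi-1
  descend zero i i-b≡0 _ | yes Pi-1 =
    ⊥-elim (ℤP.<⇒≱ (i-1<i i) (subst (_≤ i - 1ℤ) (sym (ℤP.i-j≡0⇒i≡j i b i-b≡0)) (P≥b Pi-1)))
  descend (suc n) i i-b≡1+n _ | yes Pi-1 =
    let c , c≤i-1 , Pc , ¬Pc-1 = descend n (i - 1ℤ) i-1-b≡n Pi-1
    in c , ℤP.≤-trans c≤i-1 (ℤP.<⇒≤ (i-1<i i)) , Pc , ¬Pc-1
    where
    i-1-b≡n : i - 1ℤ - b ≡ + n
    i-1-b≡n = trans (i-1-j≡i-j-1 i b) (cong (_- 1ℤ) i-b≡1+n)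
... | -[1+ _ ] | ()

⊆ₚ-refl : ∀ {P} → P ⊆ₚ P
⊆ₚ-refl {_ , _} = ℤP.≤-refl , ℤP.≤-refl

⊆ₚ-trans : ∀ {P Q R} → P ⊆ₚ Q → Q ⊆ₚ R → P ⊆ₚ R
⊆ₚ-trans {_ , _} {_ , _} {_ , _} (x≤ , y≤) (x≤′ , y≤′) = ℤP.≤-trans x≤ x≤′ , ℤP.≤-trans y≤ y≤′

⊆ₚ-antisym : ∀ {P Q} → P ⊆ₚ Q → Q ⊆ₚ P → P ≡ Q
⊆ₚ-antisym {_ , _} {_ , _} (x≤ , y≤) (x≥ , y≥) = cong₂ _,_ (ℤP.≤-antisym x≤ x≥) (ℤP.≤-antisym y≤ y≥)

Linked-predecessor : ∀ {A : Set} {R : A → A → Set} {x xs y} → Linked R (x ∷ xs) →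
                     y ∈ xs → ∃[ z ] z ∈ x ∷ xs × R z y
Linked-predecessor (Rxy ∷ _) (here refl) = _ , here refl , Rxy
Linked-predecessor (_ ∷ l) (there y∈) =
  let z , z∈ , Rzy = Linked-predecessor l y∈ in z , there z∈ , Rzy

Linked-successor : ∀ {A : Set} {R : A → A → Set} {xs x y} → Linked R xs →
                   last xs ≡ just y → x ∈ xs → x ≢ y → ∃[ z ] z ∈ xs × R x z
Linked-successor [-] refl (here refl) x≢y = ⊥-elim (x≢y refl)
Linked-successor (Rxz ∷ _) _ (here refl) _ = _ , there (here refl) , Rxz
Linked-successor (_ ∷ l) last≡y (there x∈) x≢y =
  let z , z∈ , Rxz = Linked-successor l last≡y x∈ x≢y in z , there z∈ , Rxz

MonotoneStep : Point → Point → Set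
MonotoneStep P Q = N4 P Q × P ⊂ₚ Q

monotone-step : ∀ {x y Q} → MonotoneStep (x , y) Q → Q ≡ (x + 1ℤ , y) ⊎ Q ≡ (x , y + 1ℤ)
monotone-step (inj₁ Q≡right , _) = inj₁ Q≡right
monotone-step (inj₂ (inj₁ refl) , (x≤x-1 , _) , _) = ⊥-elim (ℤP.<⇒≱ (i-1<i _) x≤x-1)
monotone-step (inj₂ (inj₂ (inj₁ Q≡up)) , _) = inj₂ Q≡up
monotone-step (inj₂ (inj₂ (inj₂ refl)) , (_ , y≤y-1) , _) = ⊥-elim (ℤP.<⇒≱ (i-1<i _) y≤y-1)

monotone-step⁻¹ : ∀ {P x y} → MonotoneStep P (x , y) → P ≡ (x - 1ℤ , y) ⊎ P ≡ (x , y - 1ℤ)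
monotone-step⁻¹ {px , py} s with monotone-step s
... | inj₁ refl = inj₁ (cong (_, py) (sym (i+1-1≡i px)))
... | inj₂ refl = inj₂ (cong (px ,_) (sym (i+1-1≡i py)))

path-head-⊆ : ∀ {P Ps Q} → MonotoneN4Path (P ∷ Ps) → Q ∈ P ∷ Ps → P ⊆ₚ Q
path-head-⊆ _ (here refl) = ⊆ₚ-refl
path-head-⊆ ((_ , P⊆P′ , _) ∷ l) (there Q∈) = ⊆ₚ-trans P⊆P′ (path-head-⊆ l Q∈)

path-comparable : ∀ {L P Q} → MonotoneN4Path L → P ∈ L → Q ∈ L → P ⊆ₚ Q ⊎ Q ⊆ₚ P
path-comparable l (here refl) Q∈ = inj₁ (path-head-⊆ l Q∈)
path-comparable l (there P∈) (here refl) = inj₂ (path-head-⊆ l (there P∈))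
path-comparable (_ ∷ l) (there P∈) (there Q∈) = path-comparable l P∈ Q∈

path-next-⊆ : ∀ {L P Q} → MonotoneN4Path L → P ∈ L → Q ∈ L → P ⊂ₚ Q →
              ∃[ P′ ] P′ ∈ L × MonotoneStep P P′ × P′ ⊆ₚ Q
path-next-⊆ _ (here refl) (here refl) (_ , P≢P) = ⊥-elim (P≢P refl)
path-next-⊆ (s ∷ l) (here refl) (there Q∈) _ = _ , there (here refl) , s , path-head-⊆ l Q∈
path-next-⊆ l (there P∈) (here refl) (P⊆Q , P≢Q) =
  ⊥-elim (P≢Q (⊆ₚ-antisym P⊆Q (path-head-⊆ l (there P∈))))
path-next-⊆ (_ ∷ l) (there P∈) (there Q∈) P⊂Q =
  let P′ , P′∈ , s , P′⊆Q = path-next-⊆ l P∈ Q∈ P⊂Q in P′ , there P′∈ , s , P′⊆Q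

path-column-up : ∀ {L x y₁ y₂} → MonotoneN4Path L → (x , y₁) ∈ L → (x , y₂) ∈ L →
                 y₁ < y₂ → (x , y₁ + 1ℤ) ∈ L
path-column-up {x = x} l P∈ Q∈ y₁<y₂
  with path-next-⊆ l P∈ Q∈ ((ℤP.≤-refl , ℤP.<⇒≤ y₁<y₂) , λ P≡Q → ℤP.<-irrefl (cong proj₂ P≡Q) y₁<y₂)
... | P′ , P′∈ , s , P′⊆Q with monotone-step s
...   | inj₁ refl = ⊥-elim (ℤP.<⇒≱ (i<i+1 x) (proj₁ P′⊆Q))
...   | inj₂ refl = P′∈

path-row-right : ∀ {L x₁ x₂ y} → MonotoneN4Path L → (x₁ , y) ∈ L → (x₂ , y) ∈ L →
                 x₁ < x₂ → (x₁ + 1ℤ , y) ∈ L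
path-row-right {y = y} l P∈ Q∈ x₁<x₂
  with path-next-⊆ l P∈ Q∈ ((ℤP.<⇒≤ x₁<x₂ , ℤP.≤-refl) , λ P≡Q → ℤP.<-irrefl (cong proj₁ P≡Q) x₁<x₂)
... | P′ , P′∈ , s , P′⊆Q with monotone-step s
...   | inj₁ refl = P′∈
...   | inj₂ refl = ⊥-elim (ℤP.<⇒≱ (i<i+1 y) (proj₂ P′⊆Q))

module _ {B : Point → Set} {xm ym : ℤ} where

  boundary-predecessor : IsBoundaryPath B xm ym → ∀ {P} → B P → P ≢ origin →
                         ∃[ Q ] B Q × MonotoneStep Q P
  boundary-predecessor (_ ∷ _ , mem , _ , mono , head≡o , _) {P} BP P≢o
    with proj₂ (mem P) BP
  ... | here refl = ⊥-elim (P≢o (just-injective head≡o))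
  ... | there P∈ = let Q , Q∈ , s = Linked-predecessor mono P∈ in Q , proj₁ (mem Q) Q∈ , s

  boundary-successor : IsBoundaryPath B xm ym → ∀ {P} → B P → P ≢ (xm , ym) →
                       ∃[ Q ] B Q × MonotoneStep P Q
  boundary-successor (_ , mem , _ , mono , _ , last≡top) {P} BP P≢top =
    let Q , Q∈ , s = Linked-successor mono last≡top (proj₂ (mem P) BP) P≢top
    in Q , proj₁ (mem Q) Q∈ , s

  boundary-comparable : IsBoundaryPath B xm ym → ∀ {P Q} → B P → B Q → P ⊆ₚ Q ⊎ Q ⊆ₚ P
  boundary-comparable (_ , mem , _ , mono , _) {P} {Q} BP BQ =
    path-comparable mono (proj₂ (mem P) BP) (proj₂ (mem Q) BQ)

  boundary-column-up : IsBoundaryPath B xm ym → ∀ {x y₁ y₂} → B (x , y₁) → B (x , y₂) →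
                       y₁ < y₂ → B (x , y₁ + 1ℤ)
  boundary-column-up (_ , mem , _ , mono , _) {x} {y₁} {y₂} BP BQ y₁<y₂ =
    proj₁ (mem _) (path-column-up mono (proj₂ (mem (x , y₁)) BP) (proj₂ (mem (x , y₂)) BQ) y₁<y₂)

  boundary-row-right : IsBoundaryPath B xm ym → ∀ {x₁ x₂ y} → B (x₁ , y) → B (x₂ , y) →
                       x₁ < x₂ → B (x₁ + 1ℤ , y)
  boundary-row-right (_ , mem , _ , mono , _) {x₁} {x₂} {y} BP BQ x₁<x₂ =
    proj₁ (mem _) (path-row-right mono (proj₂ (mem (x₁ , y)) BP) (proj₂ (mem (x₂ , y)) BQ) x₁<x₂)

row-leftmost : ∀ (S : PointSet) {x y} → (x , y) ∈ S →
               ∃[ c ] c ≤ x × (c , y) ∈ S × ¬ (c - 1ℤ , y) ∈ S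
row-leftmost S {y = y} P∈ =
  let b , b≤ = lowerBound proj₁ S in leftmost (λ i → (i , y) ∈? S) b b≤ P∈

column-lowest : ∀ (S : PointSet) {x y} → (x , y) ∈ S →
                ∃[ c ] c ≤ y × (x , c) ∈ S × ¬ (x , c - 1ℤ) ∈ S
column-lowest S {x = x} P∈ =
  let b , b≤ = lowerBound proj₂ S in leftmost (λ i → (x , i) ∈? S) b b≤ P∈

boundary⇒A1 : ∀ {S xmax ymax} → IsBoundaryPath (InUpper S) xmax ymax → A1 S
boundary⇒A1 {S} upper {x} {y} P∈ P≢o with (x - 1ℤ , y) ∈? S
... | yes left∈ = inj₁ left∈
... | no left∉ =
  let Q , (Q∈ , _) , s = boundary-predecessor upper (P∈ , inj₁ left∉) P≢o
  in Sum.map (λ Q≡left → subst (_∈ S) Q≡left Q∈) (λ Q≡down → subst (_∈ S) Q≡down Q∈)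
             (monotone-step⁻¹ s)

boundary⇒A2 : ∀ {S xmax ymax} → IsMaxX S xmax → IsMaxY S ymax →
              IsBoundaryPath (InLower S) xmax ymax → IsBoundaryPath (InUpper S) xmax ymax → A2 S
boundary⇒A2 {S} {xmax} {ymax} (_ , ≤xmax) (_ , ≤ymax) lower upper {xa} {ya} {xb} {yb} A∈ B∈ A⊈B =
  A-above-right , A-above-left , A-below-right
  where
  B≢top : (xb , yb) ≢ (xmax , ymax)
  B≢top refl = A⊈B (≤xmax A∈ , ≤ymax A∈)

  yb<ya : xa ≤ xb → yb < ya
  yb<ya xa≤xb = ℤP.≰⇒> (λ ya≤yb → A⊈B (xa≤xb , ya≤yb))

  xb<xa : ya ≤ yb → xb < xa
  xb<xa ya≤yb = ℤP.≰⇒> (λ xa≤xb → A⊈B (xa≤xb , ya≤yb))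

  A-above-right : xb ≤ xa × yb ≤ ya → (xb + 1ℤ , yb) ∈ S ⊎ (xb , yb + 1ℤ) ∈ S
  A-above-right _ with (xb , yb + 1ℤ) ∈? S
  ... | yes up∈ = inj₂ up∈
  ... | no up∉ =
    let Q , (Q∈ , _) , s = boundary-successor upper (B∈ , inj₂ (inj₁ up∉)) B≢top
    in Sum.map (λ Q≡right → subst (_∈ S) Q≡right Q∈) (λ Q≡up → subst (_∈ S) Q≡up Q∈)
               (monotone-step s)

  A-above-left : xa ≤ xb × yb ≤ ya → (xb , yb + 1ℤ) ∈ S
  A-above-left (xa≤xb , _) with (xb , yb + 1ℤ) ∈? S
  ... | yes up∈ = up∈
  ... | no up∉ with row-leftmost S A∈
  ... | xc , xc≤xa , C∈ , left∉ with boundary-comparable upper (B∈ , inj₂ (inj₁ up∉)) (C∈ , inj₁ left∉)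
  ... | inj₂ (_ , ya≤yb) = ⊥-elim (ℤP.<⇒≱ (yb<ya xa≤xb) ya≤yb)
  ... | inj₁ (xb≤xc , _) =
    proj₁ (boundary-column-up upper (B∈ , inj₂ (inj₁ up∉)) C↑ (yb<ya xa≤xb))
    where
    C↑ : InUpper S (xb , ya)
    C↑ = subst (λ x → InUpper S (x , ya)) (ℤP.≤-antisym (ℤP.≤-trans xc≤xa xa≤xb) xb≤xc)
               (C∈ , inj₁ left∉)

  A-below-right : xb ≤ xa × ya ≤ yb → (xb + 1ℤ , yb) ∈ S
  A-below-right (_ , ya≤yb) with (xb + 1ℤ , yb) ∈? S
  ... | yes right∈ = right∈
  ... | no right∉ with column-lowest S A∈
  ... | yc , yc≤ya , C∈ , down∉ with boundary-comparable lower (B∈ , inj₁ right∉) (C∈ , inj₂ (inj₁ down∉))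
  ... | inj₂ (xa≤xb , _) = ⊥-elim (ℤP.<⇒≱ (xb<xa ya≤yb) xa≤xb)
  ... | inj₁ (_ , yb≤yc) =
    proj₁ (boundary-row-right lower (B∈ , inj₁ right∉) C↓ (xb<xa ya≤yb))
    where
    C↓ : InLower S (xa , yb)
    C↓ = subst (λ y → InLower S (xa , y)) (ℤP.≤-antisym (ℤP.≤-trans yc≤ya ya≤yb) yb≤yc)
               (C∈ , inj₂ (inj₁ down∉))

lemma5 : (S : PointSet) → S ≢ [] → OrthConvex S → N4Connected S
    → origin ∈ S → (xmax ymax : ℤ) → IsMaxX S xmax → IsMaxY S ymax
    → IsBoundaryPath (InLower S) xmax ymax → IsBoundaryPath (InUpper S) xmax ymax
    → Antimatroidal S
lemma5 S S≢[] _ _ _ _ _ isMaxX isMaxY lower upper =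
  S≢[] , boundary⇒A1 upper , boundary⇒A2 isMaxX isMaxY lower upper
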